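{- If $G$ and $H$ are finite simple graphs without vertices of degree 0 that are both total Roman graphs, then $$\gamma_{tR}(G\times H)\le \frac{\gamma_{tR}(G)\gamma_{tR}(H)}{2}.$$
   Context: $\gamma_t(G)$ is the minimum size of a set $D\subseteq V(G)$ such that every vertex of $G$ has a neighbor in $D$. A function $f:V(G)\to\{0,1,2\}$ with $V_i=f^{ -1}(i)$ is a total Roman dominating function if every vertex in $V_0$ has a neighbor in $V_2$ and the subgraph induced by $V_1\cup V_2$ has no isolated vertices; $\gamma_{tR}(G)$ is the minimum of $\sum_v f(v)$ over such $f$. $G$ is a total Roman graph if $\gamma_{tR}(G)=2\gamma_t(G)$. The direct product $G\times H$ has vertex set $V(G)\times V(H)$, with $(g,h)(g',h')$ an edge iff $gg'\in E(G)$ and $hh'\in E(H)$. -}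

module Defs where

open import Data.Nat using (ℕ; _+_; _*_; _≤_)
open import Data.Fin using (Fin; toℕ; remQuot)
open import Data.Fin.Subset using (Subset; _∈_; ∣_∣)
open import Data.List using (List; map; allFin)
open import Data.Nat.ListAction using (sum)
open import Data.Product using (_×_; ∃-syntax; proj₁; proj₂)
open import Relation.Binary.PropositionalEquality using (_≡_)
open import Relation.Nullary using (¬_)

record Graph (n : ℕ) : Set₁ where
  field
    Adj   : Fin n → Fin n → Set
    sym   : ∀ {u v} → Adj u v → Adj v u
    irrefl : ∀ {v} → ¬ Adj v v
open Graph public

NoIsolated : ∀ {n} → Graph n → Set
NoIsolated {n} G = (v : Fin n) → ∃[ u ] Adj G v u

IsTotalDominating : ∀ {n} → Graph n → Subset n → Set
IsTotalDominating {n} G D = (v : Fin n) → ∃[ u ] (Adj G v u × u ∈ D)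

IsTotalDomNumber : ∀ {n} → Graph n → ℕ → Set
IsTotalDomNumber {n} G k =
  (∃[ D ] (IsTotalDominating G D × ∣ D ∣ ≡ k))
  × (∀ D → IsTotalDominating G D → k ≤ ∣ D ∣)

Labelling : ℕ → Set
Labelling n = Fin n → Fin 3

weight : ∀ {n} → Labelling n → ℕ
weight {n} f = sum (map (λ v → toℕ (f v)) (allFin n))

IsTRDF : ∀ {n} → Graph n → Labelling n → Set
IsTRDF {n} G f =
  ((v : Fin n) → toℕ (f v) ≡ 0 → ∃[ u ] (Adj G v u × toℕ (f u) ≡ 2))
  × ((v : Fin n) → ¬ (toℕ (f v) ≡ 0) → ∃[ u ] (Adj G v u × ¬ (toℕ (f u) ≡ 0)))

IsTotalRomanNumber : ∀ {n} → Graph n → ℕ → Set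
IsTotalRomanNumber {n} G k =
  (∃[ f ] (IsTRDF G f × weight f ≡ k))
  × (∀ f → IsTRDF G f → k ≤ weight f)

IsTotalRomanGraph : ∀ {n} → Graph n → Set
IsTotalRomanGraph G =
  ∃[ a ] ∃[ b ] (IsTotalDomNumber G a × IsTotalRomanNumber G b × b ≡ 2 * a)

_×ᴳ_ : ∀ {n m} → Graph n → Graph m → Graph (n * m)
_×ᴳ_ {n} {m} G H = record
  { Adj = λ i j → Adj G (proj₁ (remQuot {n} m i)) (proj₁ (remQuot {n} m j))
                × Adj H (proj₂ (remQuot {n} m i)) (proj₂ (remQuot {n} m j))
  ; sym = λ p → sym G (proj₁ p) Data.Product., sym H (proj₂ p)
  ; irrefl = λ p → irrefl G (proj₁ p)
  }

module Submission where

-- If D and E are total dominating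
-- sets of G and H, then labelling every vertex of D × E with 2 and every
-- other vertex of G × H with 0 is a total Roman dominating function of the
-- direct product: a vertex (g , h) has a neighbour d ∈ D of g and e ∈ E of h,
-- and (d , e) is then a neighbour of (g , h) carrying label 2.  Its weight is
-- 2 ∣D∣ ∣E∣, so γ_tR(G × H) ≤ 2 γ_t(G) γ_t(H).  For total Roman graphs
-- γ_tR = 2 γ_t, which turns this bound into 2 γ_tR(G × H) ≤ γ_tR(G) γ_tR(H).

open import Defs
open import Data.Nat using (ℕ; zero; suc; _+_; _*_; _≤_)
open import Data.Nat.Properties
  using (+-assoc; *-identityˡ; *-assoc; *-monoʳ-≤; ≤-antisym; +-*-semiring; module ≤-Reasoning)
open import Data.Bool using (Bool; true; false; _∧_)
open import Data.Fin using (Fin; toℕ; remQuot; combine; _↑ˡ_; _↑ʳ_)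
  renaming (zero to fzero; suc to fsuc)
open import Data.Fin.Properties using (remQuot-combine)
open import Data.Fin.Subset using (Subset; _∈_; ∣_∣)
open import Data.Vec using ([]; _∷_; lookup)
open import Data.Vec.Properties using ([]=⇒lookup)
open import Data.List using (tabulate)
open import Data.List.Properties using (map-tabulate)
open import Data.Nat.ListAction using (sum)
open import Data.Product using (_×_; _,_; ∃-syntax; proj₁; proj₂)
open import Algebra.Properties.Semiring.Sum +-*-semiring
  using (sum-syntax; sum-cong-≗; *-distribˡ-sum; *-distribʳ-sum)
  renaming (sum to ∑)
open import Relation.Binary.PropositionalEquality
  using (_≡_; refl; trans; cong; cong₂; subst; module ≡-Reasoning)
  renaming (sym to ≡-sym)
open import Relation.Nullary using (¬_)
open import Data.Nat.Tactic.RingSolver using (solve-∀)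

∑-split : ∀ m k (φ : Fin (m + k) → ℕ) →
  ∑ φ ≡ ∑ (λ i → φ (i ↑ˡ k)) + ∑ (λ j → φ (m ↑ʳ j))
∑-split zero    k φ = refl
∑-split (suc m) k φ = begin
  φ fzero + ∑ (λ i → φ (fsuc i))
    ≡⟨ cong (φ fzero +_) (∑-split m k (λ i → φ (fsuc i))) ⟩
  φ fzero + (∑ (λ i → φ (fsuc (i ↑ˡ k))) + ∑ (λ j → φ (suc m ↑ʳ j)))
    ≡⟨ ≡-sym (+-assoc (φ fzero) _ _) ⟩
  φ fzero + ∑ (λ i → φ (fsuc (i ↑ˡ k))) + ∑ (λ j → φ (suc m ↑ʳ j)) ∎
  where open ≡-Reasoning

∑-combine : ∀ n m (φ : Fin (n * m) → ℕ) →
  ∑ φ ≡ ∑[ g < n ] ∑[ h < m ] φ (combine g h)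
∑-combine zero    m φ = refl
∑-combine (suc n) m φ = trans (∑-split m (n * m) φ)
  (cong (∑ (λ h → φ (h ↑ˡ n * m)) +_) (∑-combine n m (λ k → φ (m ↑ʳ k))))

∑-remQuot : ∀ n m (F : Fin n → Fin m → ℕ) →
  ∑ (λ i → F (proj₁ (remQuot {n} m i)) (proj₂ (remQuot {n} m i)))
    ≡ ∑[ g < n ] ∑[ h < m ] F g h
∑-remQuot n m F = trans (∑-combine n m _)
  (sum-cong-≗ λ g → sum-cong-≗ λ h →
    cong (λ p → F (proj₁ p) (proj₂ p)) (remQuot-combine g h))

∑-separable : ∀ n m (a : Fin n → ℕ) (b : Fin m → ℕ) →
  ∑[ g < n ] ∑[ h < m ] (a g * b h) ≡ ∑ a * ∑ b
∑-separable n m a b = begin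
  ∑[ g < n ] ∑[ h < m ] (a g * b h)  ≡⟨ sum-cong-≗ (λ g → ≡-sym (*-distribˡ-sum (a g) b)) ⟩
  ∑[ g < n ] (a g * ∑ b)             ≡⟨ ≡-sym (*-distribʳ-sum (∑ b) a) ⟩
  ∑ a * ∑ b                          ∎
  where open ≡-Reasoning

∑-tabulate : ∀ {n} (φ : Fin n → ℕ) → sum (tabulate φ) ≡ ∑ φ
∑-tabulate {zero}  φ = refl
∑-tabulate {suc n} φ = cong (φ fzero +_) (∑-tabulate (λ i → φ (fsuc i)))

weight≡∑ : ∀ {n} (f : Labelling n) → weight f ≡ ∑ (λ v → toℕ (f v))
weight≡∑ f = trans (cong sum (map-tabulate (λ v → v) (λ v → toℕ (f v))))
                       (∑-tabulate (λ v → toℕ (f v)))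

𝟙 : Bool → ℕ
𝟙 true  = 1
𝟙 false = 0

𝟙-∧ : ∀ a b → 𝟙 (a ∧ b) ≡ 𝟙 a * 𝟙 b
𝟙-∧ true  b = ≡-sym (*-identityˡ (𝟙 b))
𝟙-∧ false b = refl

∣∣≡∑ : ∀ {n} (D : Subset n) → ∣ D ∣ ≡ ∑ (λ v → 𝟙 (lookup D v))
∣∣≡∑ []           = refl
∣∣≡∑ (true ∷ D)  = cong suc (∣∣≡∑ D)
∣∣≡∑ (false ∷ D) = ∣∣≡∑ D

-- A labelling in which every vertex has a neighbour labelled 2 is a total
-- Roman dominating function: the neighbour labelled 2 serves both as the
-- dominator of a vertex labelled 0 and as a non-zero neighbour of a vertex
-- with positive label.
neighbour2⇒TRDF : ∀ {n} (G : Graph n) (f : Labelling n) →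
  ((v : Fin n) → ∃[ u ] (Adj G v u × toℕ (f u) ≡ 2)) → IsTRDF G f
neighbour2⇒TRDF G f nb = (λ v _ → nb v) , λ v _ → nonzero (nb v)
  where
  nonzero : ∀ {v} → ∃[ u ] (Adj G v u × toℕ (f u) ≡ 2) →
            ∃[ u ] (Adj G v u × ¬ (toℕ (f u) ≡ 0))
  nonzero (u , v~u , fu≡2) = u , v~u , λ fu≡0 → 2≢0 (trans (≡-sym fu≡2) fu≡0)
    where
    2≢0 : ¬ (2 ≡ 0)
    2≢0 ()

totalRomanNumber-unique : ∀ {n} (G : Graph n) {a b} →
  IsTotalRomanNumber G a → IsTotalRomanNumber G b → a ≡ b
totalRomanNumber-unique G ((f , f-trdf , wf≡a) , a-min) ((g , g-trdf , wg≡b) , b-min) =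
  ≤-antisym (subst (_ ≤_) wg≡b (a-min g g-trdf)) (subst (_ ≤_) wf≡a (b-min f f-trdf))

totalRomanGraph-number : ∀ {n} (G : Graph n) {r} →
  IsTotalRomanGraph G → IsTotalRomanNumber G r →
  ∃[ D ] (IsTotalDominating G D × r ≡ 2 * ∣ D ∣)
totalRomanGraph-number G (a , b , ((D , D-tds , ∣D∣≡a) , _) , b-num , b≡2a) r-num =
  D , D-tds , (begin
    _       ≡⟨ totalRomanNumber-unique G r-num b-num ⟩
    b       ≡⟨ b≡2a ⟩
    2 * a   ≡⟨ cong (2 *_) (≡-sym ∣D∣≡a) ⟩
    2 * ∣ D ∣ ∎)
  where open ≡-Reasoning

twoOn : Bool → Fin 3
twoOn true  = fsuc (fsuc fzero)
twoOn false = fzero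

toℕ-twoOn : ∀ b → toℕ (twoOn b) ≡ 2 * 𝟙 b
toℕ-twoOn true  = refl
toℕ-twoOn false = refl

module ProductLabelling {n m} (G : Graph n) (H : Graph m)
                        (D : Subset n) (E : Subset m) where

  left : Fin (n * m) → Fin n
  left i = proj₁ (remQuot {n} m i)

  right : Fin (n * m) → Fin m
  right i = proj₂ (remQuot {n} m i)

  label : Labelling (n * m)
  label i = twoOn (lookup D (left i) ∧ lookup E (right i))

  weight-label : weight label ≡ 2 * (∣ D ∣ * ∣ E ∣)
  weight-label = begin
    weight label
      ≡⟨ weight≡∑ label ⟩
    ∑ (λ i → toℕ (label i))
      ≡⟨ ∑-remQuot n m (λ g h → toℕ (twoOn (lookup D g ∧ lookup E h))) ⟩
    ∑[ g < n ] ∑[ h < m ] toℕ (twoOn (lookup D g ∧ lookup E h))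
      ≡⟨ sum-cong-≗ (λ g → sum-cong-≗ (λ h → entry (lookup D g) (lookup E h))) ⟩
    ∑[ g < n ] ∑[ h < m ] (2 * 𝟙 (lookup D g) * 𝟙 (lookup E h))
      ≡⟨ ∑-separable n m (λ g → 2 * 𝟙 (lookup D g)) (λ h → 𝟙 (lookup E h)) ⟩
    ∑[ g < n ] (2 * 𝟙 (lookup D g)) * ∑[ h < m ] 𝟙 (lookup E h)
      ≡⟨ cong (_* ∑[ h < m ] 𝟙 (lookup E h)) (≡-sym (*-distribˡ-sum 2 (λ g → 𝟙 (lookup D g)))) ⟩
    2 * ∑[ g < n ] 𝟙 (lookup D g) * ∑[ h < m ] 𝟙 (lookup E h)
      ≡⟨ cong₂ (λ x y → 2 * x * y) (≡-sym (∣∣≡∑ D)) (≡-sym (∣∣≡∑ E)) ⟩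
    2 * ∣ D ∣ * ∣ E ∣
      ≡⟨ *-assoc 2 ∣ D ∣ ∣ E ∣ ⟩
    2 * (∣ D ∣ * ∣ E ∣) ∎
    where
    open ≡-Reasoning
    entry : ∀ a b → toℕ (twoOn (a ∧ b)) ≡ 2 * 𝟙 a * 𝟙 b
    entry a b = trans (toℕ-twoOn (a ∧ b))
                      (trans (cong (2 *_) (𝟙-∧ a b)) (≡-sym (*-assoc 2 (𝟙 a) (𝟙 b))))

  transport-combine : (P : Fin n → Fin m → Set) {d : Fin n} {e : Fin m} →
    P d e → P (left (combine d e)) (right (combine d e))
  transport-combine P {d} {e} =
    subst (λ p → P (proj₁ p) (proj₂ p)) (≡-sym (remQuot-combine d e))

  adj-combine : ∀ {i d e} → Adj G (left i) d → Adj H (right i) e →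
                Adj (G ×ᴳ H) i (combine d e)
  adj-combine {i} g~d h~e =
    transport-combine (λ d e → Adj G (left i) d × Adj H (right i) e) (g~d , h~e)

  label-combine : ∀ {d e} → d ∈ D → e ∈ E → toℕ (label (combine d e)) ≡ 2
  label-combine d∈D e∈E =
    transport-combine (λ d e → toℕ (twoOn (lookup D d ∧ lookup E e)) ≡ 2)
      (cong₂ (λ a b → toℕ (twoOn (a ∧ b))) ([]=⇒lookup d∈D) ([]=⇒lookup e∈E))

  label-TRDF : IsTotalDominating G D → IsTotalDominating H E → IsTRDF (G ×ᴳ H) label
  label-TRDF D-tds E-tds = neighbour2⇒TRDF (G ×ᴳ H) label neighbour
    where
    neighbour : (i : Fin (n * m)) → ∃[ j ] (Adj (G ×ᴳ H) i j × toℕ (label j) ≡ 2)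
    neighbour i with D-tds (left i) | E-tds (right i)
    ... | d , g~d , d∈D | e , h~e , e∈E =
      combine d e , adj-combine g~d h~e , label-combine d∈D e∈E

totalRomanNumber-product-≤ : ∀ {n m} (G : Graph n) (H : Graph m) {r D E} →
  IsTotalRomanNumber (G ×ᴳ H) r →
  IsTotalDominating G D → IsTotalDominating H E →
  r ≤ 2 * (∣ D ∣ * ∣ E ∣)
totalRomanNumber-product-≤ G H {D = D} {E} (_ , r-min) D-tds E-tds =
  subst (_ ≤_) weight-label (r-min label (label-TRDF D-tds E-tds))
  where open ProductLabelling G H D E

double-product : ∀ x y → 2 * (2 * (x * y)) ≡ (2 * x) * (2 * y)
double-product = solve-∀

corollary6 : ∀ {n m} (G : Graph n) (H : Graph m) →
    NoIsolated G → NoIsolated H →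
    IsTotalRomanGraph G → IsTotalRomanGraph H →
    (rG rH r : ℕ) →
    IsTotalRomanNumber G rG → IsTotalRomanNumber H rH →
    IsTotalRomanNumber (G ×ᴳ H) r →
    2 * r ≤ rG * rH
corollary6 G H _ _ G-roman H-roman rG rH r rG-num rH-num r-num
  with totalRomanGraph-number G G-roman rG-num | totalRomanGraph-number H H-roman rH-num
... | D , D-tds , rG≡2∣D∣ | E , E-tds , rH≡2∣E∣ = begin
  2 * r                       ≤⟨ *-monoʳ-≤ 2 (totalRomanNumber-product-≤ G H r-num D-tds E-tds) ⟩
  2 * (2 * (∣ D ∣ * ∣ E ∣))   ≡⟨ double-product ∣ D ∣ ∣ E ∣ ⟩
  (2 * ∣ D ∣) * (2 * ∣ E ∣)   ≡⟨ cong₂ _*_ (≡-sym rG≡2∣D∣) (≡-sym rH≡2∣E∣) ⟩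
  rG * rH                     ∎
  where open ≤-Reasoning
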